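{- Let $q$ be a prime power and $d\ge 2$. Let $f,g:\mathbb{F}_q^d\to\mathbb{F}_q$ be the linear bipermutive local rules $f(x_0,\dots,x_{d-1})=a_0x_0+\dots+a_{d-1}x_{d-1}$ and $g(x_0,\dots,x_{d-1})=b_0x_0+\dots+b_{d-1}x_{d-1}$ (so $a_0,a_{d-1},b_0,b_{d-1}\neq 0$), and let $F,G:\mathbb{F}_q^{2(d-1)}\to\mathbb{F}_q^{d-1}$ be the no-boundary cellular automata of length $2(d-1)$ defined by $f$ and $g$. Then the Latin squares $L_F$ and $L_G$ of order $q^{d-1}$ generated by $F$ and $G$ are orthogonal if and only if the polynomials $p_f(X)=a_0+a_1X+\dots+a_{d-1}X^{d-1}$ and $p_g(X)=b_0+b_1X+\dots+b_{d-1}X^{d-1}$ in $\mathbb{F}_q[X]$ are relatively prime.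
   Context: For $n\ge d$, the no-boundary cellular automaton $F:A^n\to A^{n-d+1}$ of length $n$ with local rule $f:A^d\to A$ is $F(x_0,\dots,x_{n-1})=(f(x_0,\dots,x_{d-1}),\dots,f(x_{n-d},\dots,x_{n-1}))$. A linear rule $f=\sum a_ix_i$ over $\mathbb{F}_q$ is bipermutive iff $a_0\ne0$ and $a_{d-1}\ne0$. Fix a bijection $\phi:\mathbb{F}_q^{d-1}\to\{1,\dots,q^{d-1}\}$ with inverse $\psi$; the Latin square generated by $F:\mathbb{F}_q^{2(d-1)}\to\mathbb{F}_q^{d-1}$ is the $q^{d-1}\times q^{d-1}$ matrix $L_F(i,j)=\phi(F(\psi(i)\|\psi(j)))$, where $\|$ is concatenation. Two Latin squares $L_1,L_2$ of order $N$ are orthogonal if the pairs $(L_1(i,j),L_2(i,j))$, $(i,j)\in[N]^2$, are pairwise distinct. -}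

module Defs where

open import Level using (0ℓ)
open import Data.Nat using (ℕ; zero; suc; _+_; _∸_; _^_; _≤_; _<_; s≤s; z≤n)
open import Data.Nat.Properties using (m≤n+m; m+n∸n≡m; m∸n+n≡m; +-mono-≤-<)
open import Data.Fin using (Fin; toℕ; fromℕ<)
open import Data.Fin.Properties using (toℕ≤pred[n]; toℕ<n)
open import Data.Vec using (Vec; lookup; tabulate; _++_; cast; toList; foldr; zipWith)
open import Data.List using (List; []; _∷_; map)
open import Data.Product using (Σ; ∃; _×_; _,_)
open import Data.Sum using (_⊎_)
open import Relation.Nullary using (¬_)
open import Relation.Binary.PropositionalEquality using (_≡_; _≢_; refl; subst; cong)
open import Algebra.Structures using (IsCommutativeRing)
open import Function.Bundles using (_↔_; Inverse)

-- Finite fields (F_q): a commutative ring (w.r.t. propositional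
-- equality) in which 0 ≠ 1 and every nonzero element is invertible,
-- whose carrier is in bijection with Fin q.  (The size q of a finite
-- field is automatically a prime power, and every prime power arises.)

record FiniteField : Set₁ where
  infixl 6 _+ᶠ_
  infixl 7 _*ᶠ_
  field
    K     : Set
    _+ᶠ_  : K → K → K
    _*ᶠ_  : K → K → K
    -ᶠ_   : K → K
    0ᶠ    : K
    1ᶠ    : K
    isCommutativeRing : IsCommutativeRing _≡_ _+ᶠ_ _*ᶠ_ -ᶠ_ 0ᶠ 1ᶠ
    0≢1   : 0ᶠ ≢ 1ᶠ
    inv   : ∀ x → x ≢ 0ᶠ → ∃ λ y → x *ᶠ y ≡ 1ᶠ
    q     : ℕ
    enum  : K ↔ Fin q

private
  window< : ∀ {n d} → d ≤ n → (i : Fin (suc (n ∸ d))) (j : Fin d) →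
            toℕ i + toℕ j < n
  window< {n} {d} d≤n i j =
    subst (toℕ i + toℕ j <_) (m∸n+n≡m d≤n)
          (+-mono-≤-< (toℕ≤pred[n] i) (toℕ<n j))

d≤2[d-1] : ∀ d → 2 ≤ d → d ≤ (d ∸ 1) + (d ∸ 1)
d≤2[d-1] (suc (suc e)) (s≤s (s≤s _)) = s≤s (m≤n+m (suc e) e)

len≡d-1 : ∀ d → 2 ≤ d → suc (((d ∸ 1) + (d ∸ 1)) ∸ d) ≡ d ∸ 1
len≡d-1 (suc (suc e)) (s≤s (s≤s _)) = cong suc (m+n∸n≡m e (suc e))

module _ (𝔽 : FiniteField) where
  open FiniteField 𝔽

  linearRule : ∀ {d} → Vec K d → Vec K d → K
  linearRule a x = foldr _ _+ᶠ_ 0ᶠ (zipWith _*ᶠ_ a x)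

  Bipermutive : ∀ {d} → Vec K d → Set
  Bipermutive {d} a = ∀ (i : Fin d) → (toℕ i ≡ 0 ⊎ suc (toℕ i) ≡ d) →
                      lookup a i ≢ 0ᶠ

  noBoundaryCA : ∀ {n d} → d ≤ n → (Vec K d → K) → Vec K n → Vec K (suc (n ∸ d))
  noBoundaryCA {n} {d} d≤n f x =
    tabulate λ i → f (tabulate λ j → lookup x (fromℕ< (window< d≤n i j)))

  -- The CA of length 2(d-1), viewed as a map F_q^{2(d-1)} → F_q^{d-1}
  -- (the output length n-d+1 equals d-1; `cast` only re-indexes).
  CA2 : ∀ d → 2 ≤ d → (Vec K d → K) → Vec K ((d ∸ 1) + (d ∸ 1)) → Vec K (d ∸ 1)
  CA2 d 2≤d f x = cast (len≡d-1 d 2≤d) (noBoundaryCA (d≤2[d-1] d 2≤d) f x)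

  -- Latin square generated by F w.r.t. a bijection φ : F_q^{d-1} ↔ [q^{d-1}]
  -- (indices 1..N are represented by Fin N)

  latinSquare : ∀ {k} → (φ : Vec K k ↔ Fin (q ^ k)) →
                (Vec K (k + k) → Vec K k) →
                Fin (q ^ k) → Fin (q ^ k) → Fin (q ^ k)
  latinSquare φ F i j = Inverse.to φ (F (Inverse.from φ i ++ Inverse.from φ j))

  -- Polynomials over K as coefficient lists (constant term first),
  -- compared coefficientwise (trailing zeros irrelevant).

  Poly : Set
  Poly = List K

  coeff : Poly → ℕ → K
  coeff []      _       = 0ᶠ
  coeff (c ∷ p) zero    = c
  coeff (c ∷ p) (suc n) = coeff p n

  _≈ₚ_ : Poly → Poly → Set
  p ≈ₚ r = ∀ n → coeff p n ≡ coeff r n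

  _+ₚ_ : Poly → Poly → Poly
  []      +ₚ r       = r
  (c ∷ p) +ₚ []      = c ∷ p
  (c ∷ p) +ₚ (e ∷ r) = (c +ᶠ e) ∷ (p +ₚ r)

  _*ₚ_ : Poly → Poly → Poly
  []      *ₚ r = []
  (c ∷ p) *ₚ r = map (c *ᶠ_) r +ₚ (0ᶠ ∷ (p *ₚ r))

  _∣ₚ_ : Poly → Poly → Set
  c ∣ₚ p = ∃ λ s → (c *ₚ s) ≈ₚ p

  IsUnitₚ : Poly → Set
  IsUnitₚ c = ∃ λ s → (c *ₚ s) ≈ₚ (1ᶠ ∷ [])

  RelPrime : Poly → Poly → Set
  RelPrime p r = ∀ c → c ∣ₚ p → c ∣ₚ r → IsUnitₚ c

  rulePoly : ∀ {d} → Vec K d → Poly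
  rulePoly a = toList a

Orthogonal : ∀ {N} → (Fin N → Fin N → Fin N) → (Fin N → Fin N → Fin N) → Set
Orthogonal L₁ L₂ = ∀ i j i' j' → L₁ i j ≡ L₁ i' j' → L₂ i j ≡ L₂ i' j' →
                   i ≡ i' × j ≡ j'

-- Polynomials act on sequences z : ℕ → K by (p · z) i = Σⱼ pⱼ z (i + j); the action is faithful and
-- commutative, and output i of the automaton with rule a on the word w is (p_a · w) i. Orthogonality of
-- L_F and L_G says that w ↦ (F w, G w) is injective on words of length 2(d-1), i.e. that no nonzero word
-- has p_a · w and p_b · w vanishing on the first d-1 windows.
-- If p_a and p_b are coprime, Euclid's algorithm gives u p_a + v p_b = 1. As a_{d-1} is invertible, such
-- a word extends to a solution z of p_a · z = 0; then p_b · z solves the same recurrence and starts with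
-- d-1 zeros, so it vanishes, and z = u (p_a · z) + v (p_b · z) = 0.
-- Conversely, a common factor of positive degree has a solution z of its recurrence with z 0 = 1, and both
-- automata send the prefix of z to the same outputs as the zero word; a constant common factor is a unit,
-- and the zero polynomial does not divide p_a since a_0 ≠ 0.
module Submission where

open import Defs hiding (Poly; coeff; _≈ₚ_; _+ₚ_; _*ₚ_; _∣ₚ_)
import Defs as D
open import Level using (0ℓ)
open import Data.Nat using (ℕ; zero; suc; _≤_; _<_; _∸_; _^_; _+_; s≤s; z≤n; s≤s⁻¹; _<?_; _≤?_)
open import Data.Nat.Properties
  using (+-identityʳ; +-suc; +-comm; m<1+n⇒m<n∨m≡n; m≤n⇒m<n∨m≡n; ≰⇒>; <⇒≤; ≤-refl; ≤-trans;
         <-≤-trans; +-monoˡ-<; +-monoʳ-<; +-mono-<-≤; m∸n+n≡m; m≤m+n; <-irrefl; m<n⇒m<1+n;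
         m+[n∸m]≡n; m∸[m∸n]≡n; ∸-monoˡ-≤; m∸n≤m; ≤-pred; +-mono-≤-<)
open import Data.Fin as Fin using (Fin; toℕ; fromℕ; fromℕ<)
open import Data.Fin.Properties using (toℕ-fromℕ<; toℕ-fromℕ; toℕ-cast; toℕ<n; toℕ≤pred[n]; inj⇒≟)
open import Data.Vec using (Vec; []; _∷_; lookup; tabulate; toList; init; last; splitAt; _++_)
open import Data.Vec.Properties using (lookup∘tabulate; tabulate∘lookup; tabulate-cong; lookup-cast₁; ++-injective)
open import Data.List using ([]; _∷_; map)
open import Data.Sum using (inj₁; inj₂)
open import Data.Product using (Σ; _×_; _,_; proj₁; proj₂)
open import Data.Empty using (⊥-elim)
open import Function using (_∘_; _↔_; _⇔_; mk⇔; Inverse; Injection; Equivalence)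
open import Function.Properties.Inverse using (↔⇒↣; ↔-sym)
open import Relation.Nullary using (yes; no)
open import Relation.Binary.Definitions using (DecidableEquality)
open import Relation.Binary.PropositionalEquality
open import Algebra.Bundles using (CommutativeRing)
import Algebra.Properties.Ring as RingProperties
import Algebra.Properties.CommutativeSemigroup as CommutativeSemigroupProperties

lookup-fromℕ : ∀ {A : Set} {n} (v : Vec A (suc n)) → lookup v (fromℕ n) ≡ last v
lookup-fromℕ {n = zero}  (x ∷ []) = refl
lookup-fromℕ {n = suc n} (x ∷ v)  = lookup-fromℕ v

JointlyInjective : {A B C : Set} → (A → B) → (A → C) → Set
JointlyInjective F G = ∀ w w′ → F w ≡ F w′ → G w ≡ G w′ → w ≡ w′

module _ (𝔽 : FiniteField) where
  open FiniteField 𝔽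
  open ≡-Reasoning

  private
    commutativeRing : CommutativeRing 0ℓ 0ℓ
    commutativeRing = record { isCommutativeRing = isCommutativeRing }

  open CommutativeRing commutativeRing
    using (+-assoc; +-identityˡ; -‿inverseʳ; *-assoc; *-comm;
           *-identityˡ; *-identityʳ; distribˡ; distribʳ; zeroˡ; zeroʳ;
           ring; +-commutativeSemigroup; *-commutativeSemigroup)
    renaming (+-identityʳ to +ᶠ-identityʳ; +-comm to +ᶠ-comm)
  open RingProperties ring
    using (-‿distribʳ-*; -‿distribˡ-*; -‿+-comm; -0#≈0#; x∙y⁻¹≈ε⇒x≈y; x≈y⇒x∙y⁻¹≈ε; //-rightDividesʳ)
  open CommutativeSemigroupProperties +-commutativeSemigroup using (interchange; x∙yz≈xz∙y)
  open CommutativeSemigroupProperties *-commutativeSemigroup using () renaming (x∙yz≈y∙xz to x*yz≈y*xz)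

  Poly : Set
  Poly = D.Poly 𝔽

  coeff : Poly → ℕ → K
  coeff = D.coeff 𝔽

  infix 4 _≈ₚ_ _∣ₚ_
  infixl 6 _+ₚ_
  infixl 7 _*ₚ_

  _≈ₚ_ : Poly → Poly → Set
  _≈ₚ_ = D._≈ₚ_ 𝔽

  _+ₚ_ _*ₚ_ : Poly → Poly → Poly
  _+ₚ_ = D._+ₚ_ 𝔽
  _*ₚ_ = D._*ₚ_ 𝔽

  _∣ₚ_ : Poly → Poly → Set
  _∣ₚ_ = D._∣ₚ_ 𝔽

  _≟_ : DecidableEquality K
  _≟_ = inj⇒≟ (↔⇒↣ enum)

  x*y≡0⇒y≡0 : ∀ {x ι y} → x *ᶠ ι ≡ 1ᶠ → x *ᶠ y ≡ 0ᶠ → y ≡ 0ᶠ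
  x*y≡0⇒y≡0 {x} {ι} {y} xι≡1 xy≡0 = begin
    y               ≡⟨ sym (*-identityˡ y) ⟩
    1ᶠ *ᶠ y          ≡⟨ cong (_*ᶠ y) (trans (sym xι≡1) (*-comm x ι)) ⟩
    (ι *ᶠ x) *ᶠ y    ≡⟨ *-assoc ι x y ⟩
    ι *ᶠ (x *ᶠ y)    ≡⟨ cong (ι *ᶠ_) xy≡0 ⟩
    ι *ᶠ 0ᶠ          ≡⟨ zeroʳ ι ⟩
    0ᶠ               ∎

  Seq : Set
  Seq = ℕ → K

  0ₛ : Seq
  0ₛ _ = 0ᶠ

  infixl 6 _+ₛ_ _-ₛ_

  _+ₛ_ _-ₛ_ : Seq → Seq → Seq
  (z +ₛ w) m = z m +ᶠ w m
  (z -ₛ w) m = z m +ᶠ -ᶠ w m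

  _*ₛ_ : K → Seq → Seq
  (c *ₛ z) m = c *ᶠ z m

  -- K[X] acts on sequences with X as the left shift: act p z i = Σⱼ pⱼ z (i + j).
  act : Poly → Seq → Seq
  act []      z i = 0ᶠ
  act (c ∷ p) z i = c *ᶠ z i +ᶠ act p z (suc i)

  act-cong : ∀ p {z w} → (∀ m → z m ≡ w m) → ∀ i → act p z i ≡ act p w i
  act-cong []      z≗w i = refl
  act-cong (c ∷ p) z≗w i = cong₂ _+ᶠ_ (cong (c *ᶠ_) (z≗w i)) (act-cong p z≗w (suc i))

  act-shift : ∀ p z i → act p (z ∘ suc) i ≡ act p z (suc i)
  act-shift []      z i = refl
  act-shift (c ∷ p) z i = cong (c *ᶠ z (suc i) +ᶠ_) (act-shift p z (suc i))

  act-0ₛ : ∀ p i → act p 0ₛ i ≡ 0ᶠ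
  act-0ₛ []      i = refl
  act-0ₛ (c ∷ p) i = begin
    c *ᶠ 0ᶠ +ᶠ act p 0ₛ (suc i)  ≡⟨ cong₂ _+ᶠ_ (zeroʳ c) (act-0ₛ p (suc i)) ⟩
    0ᶠ +ᶠ 0ᶠ                     ≡⟨ +-identityˡ 0ᶠ ⟩
    0ᶠ                           ∎

  act-vanishes : ∀ p {z} → (∀ m → z m ≡ 0ᶠ) → ∀ i → act p z i ≡ 0ᶠ
  act-vanishes p z≗0 i = trans (act-cong p z≗0 i) (act-0ₛ p i)

  act-+ₛ : ∀ p z w i → act p (z +ₛ w) i ≡ act p z i +ᶠ act p w i
  act-+ₛ []      z w i = sym (+-identityˡ 0ᶠ)
  act-+ₛ (c ∷ p) z w i = begin
    c *ᶠ (z i +ᶠ w i) +ᶠ act p (z +ₛ w) (suc i)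
      ≡⟨ cong₂ _+ᶠ_ (distribˡ c (z i) (w i)) (act-+ₛ p z w (suc i)) ⟩
    (c *ᶠ z i +ᶠ c *ᶠ w i) +ᶠ (act p z (suc i) +ᶠ act p w (suc i))
      ≡⟨ interchange _ _ _ _ ⟩
    (c *ᶠ z i +ᶠ act p z (suc i)) +ᶠ (c *ᶠ w i +ᶠ act p w (suc i))  ∎

  act--ₛ : ∀ p z w i → act p (z -ₛ w) i ≡ act p z i +ᶠ -ᶠ act p w i
  act--ₛ []      z w i = sym (trans (cong (0ᶠ +ᶠ_) -0#≈0#) (+-identityˡ 0ᶠ))
  act--ₛ (c ∷ p) z w i = begin
    c *ᶠ (z i +ᶠ -ᶠ w i) +ᶠ act p (z -ₛ w) (suc i)
      ≡⟨ cong₂ _+ᶠ_ (trans (distribˡ c (z i) (-ᶠ w i)) (cong (c *ᶠ z i +ᶠ_) (sym (-‿distribʳ-* c (w i)))))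
                    (act--ₛ p z w (suc i)) ⟩
    (c *ᶠ z i +ᶠ -ᶠ (c *ᶠ w i)) +ᶠ (act p z (suc i) +ᶠ -ᶠ act p w (suc i))
      ≡⟨ interchange _ _ _ _ ⟩
    (c *ᶠ z i +ᶠ act p z (suc i)) +ᶠ (-ᶠ (c *ᶠ w i) +ᶠ -ᶠ act p w (suc i))
      ≡⟨ cong ((c *ᶠ z i +ᶠ act p z (suc i)) +ᶠ_) (-‿+-comm _ _) ⟩
    (c *ᶠ z i +ᶠ act p z (suc i)) +ᶠ -ᶠ (c *ᶠ w i +ᶠ act p w (suc i))  ∎

  act-*ₛ : ∀ p c z i → act p (c *ₛ z) i ≡ c *ᶠ act p z i
  act-*ₛ []      c z i = sym (zeroʳ c)
  act-*ₛ (e ∷ p) c z i = begin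
    e *ᶠ (c *ᶠ z i) +ᶠ act p (c *ₛ z) (suc i)
      ≡⟨ cong₂ _+ᶠ_ (x*yz≈y*xz e c (z i)) (act-*ₛ p c z (suc i)) ⟩
    c *ᶠ (e *ᶠ z i) +ᶠ c *ᶠ act p z (suc i)
      ≡⟨ sym (distribˡ c _ _) ⟩
    c *ᶠ (e *ᶠ z i +ᶠ act p z (suc i))  ∎

  act-+ₚ : ∀ p r z i → act (p +ₚ r) z i ≡ act p z i +ᶠ act r z i
  act-+ₚ []      r       z i = sym (+-identityˡ _)
  act-+ₚ (c ∷ p) []      z i = sym (+ᶠ-identityʳ _)
  act-+ₚ (c ∷ p) (e ∷ r) z i = begin
    (c +ᶠ e) *ᶠ z i +ᶠ act (p +ₚ r) z (suc i)
      ≡⟨ cong₂ _+ᶠ_ (distribʳ (z i) c e) (act-+ₚ p r z (suc i)) ⟩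
    (c *ᶠ z i +ᶠ e *ᶠ z i) +ᶠ (act p z (suc i) +ᶠ act r z (suc i))
      ≡⟨ interchange _ _ _ _ ⟩
    (c *ᶠ z i +ᶠ act p z (suc i)) +ᶠ (e *ᶠ z i +ᶠ act r z (suc i))  ∎

  act-map-* : ∀ c r z i → act (map (c *ᶠ_) r) z i ≡ c *ᶠ act r z i
  act-map-* c []      z i = sym (zeroʳ c)
  act-map-* c (e ∷ r) z i = begin
    (c *ᶠ e) *ᶠ z i +ᶠ act (map (c *ᶠ_) r) z (suc i)
      ≡⟨ cong₂ _+ᶠ_ (*-assoc c e (z i)) (act-map-* c r z (suc i)) ⟩
    c *ᶠ (e *ᶠ z i) +ᶠ c *ᶠ act r z (suc i)
      ≡⟨ sym (distribˡ c _ _) ⟩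
    c *ᶠ (e *ᶠ z i +ᶠ act r z (suc i))  ∎

  act-map-neg : ∀ p z i → act (map -ᶠ_ p) z i ≡ -ᶠ act p z i
  act-map-neg []      z i = sym -0#≈0#
  act-map-neg (c ∷ p) z i = begin
    -ᶠ c *ᶠ z i +ᶠ act (map -ᶠ_ p) z (suc i)
      ≡⟨ cong₂ _+ᶠ_ (sym (-‿distribˡ-* c (z i))) (act-map-neg p z (suc i)) ⟩
    -ᶠ (c *ᶠ z i) +ᶠ -ᶠ act p z (suc i)
      ≡⟨ -‿+-comm _ _ ⟩
    -ᶠ (c *ᶠ z i +ᶠ act p z (suc i))  ∎

  act-*ₚ : ∀ p r z i → act (p *ₚ r) z i ≡ act p (act r z) i
  act-*ₚ []      r z i = refl
  act-*ₚ (c ∷ p) r z i = begin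
    act (map (c *ᶠ_) r +ₚ (0ᶠ ∷ p *ₚ r)) z i
      ≡⟨ act-+ₚ (map (c *ᶠ_) r) (0ᶠ ∷ p *ₚ r) z i ⟩
    act (map (c *ᶠ_) r) z i +ᶠ (0ᶠ *ᶠ z i +ᶠ act (p *ₚ r) z (suc i))
      ≡⟨ cong₂ _+ᶠ_ (act-map-* c r z i)
                    (trans (cong (_+ᶠ act (p *ₚ r) z (suc i)) (zeroˡ (z i))) (+-identityˡ _)) ⟩
    c *ᶠ act r z i +ᶠ act (p *ₚ r) z (suc i)
      ≡⟨ cong (c *ᶠ act r z i +ᶠ_) (act-*ₚ p r z (suc i)) ⟩
    c *ᶠ act r z i +ᶠ act p (act r z) (suc i)  ∎

  act-comm : ∀ p r z i → act p (act r z) i ≡ act r (act p z) i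
  act-comm []      r z i = sym (act-0ₛ r i)
  act-comm (c ∷ p) r z i = begin
    c *ᶠ act r z i +ᶠ act p (act r z) (suc i)
      ≡⟨ cong (c *ᶠ act r z i +ᶠ_) (act-comm p r z (suc i)) ⟩
    c *ᶠ act r z i +ᶠ act r (act p z) (suc i)
      ≡⟨ cong₂ _+ᶠ_ (sym (act-*ₛ r c z i)) (sym (act-shift r (act p z) i)) ⟩
    act r (c *ₛ z) i +ᶠ act r (act p z ∘ suc) i
      ≡⟨ sym (act-+ₛ r (c *ₛ z) (act p z ∘ suc) i) ⟩
    act r (act (c ∷ p) z) i  ∎

  act-singleton : ∀ c z i → act (c ∷ []) z i ≡ c *ᶠ z i
  act-singleton c z i = +ᶠ-identityʳ _

  basis : ℕ → Seq
  basis zero    zero    = 1ᶠ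
  basis zero    (suc m) = 0ᶠ
  basis (suc n) zero    = 0ᶠ
  basis (suc n) (suc m) = basis n m

  act-basis : ∀ p s n → act p (basis (s + n)) s ≡ coeff p n
  act-basis p (suc s) n = trans (sym (act-shift p (basis (suc s + n)) s)) (act-basis p s n)
  act-basis []      zero n       = refl
  act-basis (c ∷ p) zero zero    = begin
    c *ᶠ 1ᶠ +ᶠ act p (basis 0) 1
      ≡⟨ cong₂ _+ᶠ_ (*-identityʳ c) (trans (sym (act-shift p (basis 0) 0)) (act-0ₛ p 0)) ⟩
    c +ᶠ 0ᶠ  ≡⟨ +ᶠ-identityʳ c ⟩
    c        ∎
  act-basis (c ∷ p) zero (suc n) = begin
    c *ᶠ 0ᶠ +ᶠ act p (basis (suc n)) 1  ≡⟨ cong₂ _+ᶠ_ (zeroʳ c) (act-basis p 1 n) ⟩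
    0ᶠ +ᶠ coeff p n                      ≡⟨ +-identityˡ _ ⟩
    coeff p n                            ∎

  act-injective : ∀ p r → (∀ z i → act p z i ≡ act r z i) → p ≈ₚ r
  act-injective p r p≗r n = trans (sym (act-basis p 0 n)) (trans (p≗r (basis n) 0) (act-basis r 0 n))

  act-vanishes-≈ₚ : ∀ r → r ≈ₚ [] → ∀ z i → act r z i ≡ 0ᶠ
  act-vanishes-≈ₚ []      r≈0 z i = refl
  act-vanishes-≈ₚ (e ∷ r) r≈0 z i = begin
    e *ᶠ z i +ᶠ act r z (suc i)
      ≡⟨ cong₂ _+ᶠ_ (trans (cong (_*ᶠ z i) (r≈0 0)) (zeroˡ (z i)))
                    (act-vanishes-≈ₚ r (r≈0 ∘ suc) z (suc i)) ⟩
    0ᶠ +ᶠ 0ᶠ  ≡⟨ +-identityˡ 0ᶠ ⟩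
    0ᶠ        ∎

  act-resp-≈ₚ : ∀ p r → p ≈ₚ r → ∀ z i → act p z i ≡ act r z i
  act-resp-≈ₚ []      r       p≈r z i = sym (act-vanishes-≈ₚ r (sym ∘ p≈r) z i)
  act-resp-≈ₚ (c ∷ p) []      p≈r z i = act-vanishes-≈ₚ (c ∷ p) p≈r z i
  act-resp-≈ₚ (c ∷ p) (e ∷ r) p≈r z i =
    cong₂ _+ᶠ_ (cong (_*ᶠ z i) (p≈r 0)) (act-resp-≈ₚ p r (p≈r ∘ suc) z (suc i))

  act-local : ∀ {n} (v : Vec K n) {s t i j} → (∀ m → m < n → s (i + m) ≡ t (j + m)) →
              act (toList v) s i ≡ act (toList v) t j
  act-local []      s≗t = refl
  act-local {suc n} (c ∷ v) {s} {t} {i} {j} s≗t = cong₂ _+ᶠ_ (cong (c *ᶠ_) first) (act-local v rest)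
    where
    first : s i ≡ t j
    first = subst₂ (λ m m′ → s m ≡ t m′) (+-identityʳ i) (+-identityʳ j) (s≗t 0 (s≤s z≤n))
    rest : ∀ m → m < n → s (suc i + m) ≡ t (suc j + m)
    rest m m<n = subst₂ (λ x y → s x ≡ t y) (+-suc i m) (+-suc j m) (s≗t (suc m) (s≤s m<n))

  act-last : ∀ {k} (a : Vec K (suc k)) z i →
             act (toList a) z i ≡ act (toList (init a)) z i +ᶠ last a *ᶠ z (i + k)
  act-last {zero}  (c ∷ []) z i = begin
    c *ᶠ z i +ᶠ 0ᶠ        ≡⟨ +ᶠ-identityʳ _ ⟩
    c *ᶠ z i              ≡⟨ cong (λ m → c *ᶠ z m) (sym (+-identityʳ i)) ⟩
    c *ᶠ z (i + 0)        ≡⟨ sym (+-identityˡ _) ⟩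
    0ᶠ +ᶠ c *ᶠ z (i + 0)  ∎
  act-last {suc k} (c ∷ a) z i = begin
    c *ᶠ z i +ᶠ act (toList a) z (suc i)
      ≡⟨ cong (c *ᶠ z i +ᶠ_) (act-last a z (suc i)) ⟩
    c *ᶠ z i +ᶠ (act (toList (init a)) z (suc i) +ᶠ last a *ᶠ z (suc i + k))
      ≡⟨ sym (+-assoc _ _ _) ⟩
    (c *ᶠ z i +ᶠ act (toList (init a)) z (suc i)) +ᶠ last a *ᶠ z (suc i + k)
      ≡⟨ cong (λ m → (c *ᶠ z i +ᶠ act (toList (init a)) z (suc i)) +ᶠ last a *ᶠ z m) (sym (+-suc i k)) ⟩
    (c *ᶠ z i +ᶠ act (toList (init a)) z (suc i)) +ᶠ last a *ᶠ z (i + suc k)  ∎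

  monomial : ℕ → K → Poly
  monomial zero    τ = τ ∷ []
  monomial (suc s) τ = 0ᶠ ∷ monomial s τ

  act-monomial : ∀ s τ z i → act (monomial s τ) z i ≡ τ *ᶠ z (i + s)
  act-monomial zero    τ z i = trans (act-singleton τ z i) (cong (λ m → τ *ᶠ z m) (sym (+-identityʳ i)))
  act-monomial (suc s) τ z i = begin
    0ᶠ *ᶠ z i +ᶠ act (monomial s τ) z (suc i)  ≡⟨ cong₂ _+ᶠ_ (zeroˡ (z i)) (act-monomial s τ z (suc i)) ⟩
    0ᶠ +ᶠ τ *ᶠ z (suc i + s)                    ≡⟨ +-identityˡ _ ⟩
    τ *ᶠ z (suc i + s)                          ≡⟨ cong (λ m → τ *ᶠ z m) (sym (+-suc i s)) ⟩
    τ *ᶠ z (i + suc s)                          ∎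

  act-+* : ∀ p M r z i → act (p +ₚ M *ₚ r) z i ≡ act p z i +ᶠ act M (act r z) i
  act-+* p M r z i = trans (act-+ₚ p (M *ₚ r) z i) (cong (act p z i +ᶠ_) (act-*ₚ M r z i))

  data LeadingForm (p : Poly) : Set where
    zeroPoly : p ≈ₚ [] → LeadingForm p
    leading  : ∀ {n} (v : Vec K (suc n)) → last v ≢ 0ᶠ → p ≈ₚ toList v → LeadingForm p

  leadingForm : ∀ p → LeadingForm p
  leadingForm []      = zeroPoly λ _ → refl
  leadingForm (x ∷ p) with leadingForm p
  ... | leading v v≢0 p≈v = leading (x ∷ v) v≢0 λ { zero → refl ; (suc n) → p≈v n }
  ... | zeroPoly p≈0 with x ≟ 0ᶠ
  ...   | yes x≡0 = zeroPoly λ { zero → x≡0 ; (suc n) → p≈0 n }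
  ...   | no x≢0  = leading (x ∷ []) x≢0 λ { zero → refl ; (suc n) → p≈0 n }

  DegreeBelow : ℕ → Poly → Set
  DegreeBelow l p = ∀ j → l ≤ j → coeff p j ≡ 0ᶠ

  toList-degreeBelow : ∀ {n} (v : Vec K n) → DegreeBelow n (toList v)
  toList-degreeBelow []      j       _         = refl
  toList-degreeBelow (x ∷ v) (suc j) (s≤s n≤j) = toList-degreeBelow v j n≤j

  coeff-toList-last : ∀ {n} (v : Vec K (suc n)) → coeff (toList v) n ≡ last v
  coeff-toList-last {zero}  (x ∷ []) = refl
  coeff-toList-last {suc n} (x ∷ v)  = coeff-toList-last v

  leading-degree< : ∀ {n l} p (v : Vec K (suc n)) → last v ≢ 0ᶠ → p ≈ₚ toList v → DegreeBelow l p → n < l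
  leading-degree< {n} {l} p v v≢0 p≈v deg with l ≤? n
  ... | yes l≤n = ⊥-elim (v≢0 (trans (sym (coeff-toList-last v)) (trans (sym (p≈v n)) (deg n l≤n))))
  ... | no l≰n  = ≰⇒> l≰n

  -- Subtracting (last vp / last vr) X^(m ∸ n) r from p kills its leading coefficient.
  cancel-leading : ∀ {m n} p r (vp : Vec K (suc m)) (vr : Vec K (suc n)) → last vr ≢ 0ᶠ → n ≤ m →
                   p ≈ₚ toList vp → r ≈ₚ toList vr → Σ Poly λ M → DegreeBelow m (p +ₚ M *ₚ r)
  cancel-leading {m} {n} p r vp vr vr≢0 n≤m p≈vp r≈vr = monomial s τ , degree
    where
    s : ℕ
    s = m ∸ n
    ι : K
    ι = proj₁ (inv (last vr) vr≢0)
    τ : K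
    τ = -ᶠ (last vp *ᶠ ι)

    coeff-shifted : ∀ j → coeff (p +ₚ monomial s τ *ₚ r) (s + j) ≡ coeff p (s + j) +ᶠ τ *ᶠ coeff r j
    coeff-shifted j = begin
      coeff (p +ₚ monomial s τ *ₚ r) (s + j)
        ≡⟨ sym (act-basis (p +ₚ monomial s τ *ₚ r) 0 (s + j)) ⟩
      act (p +ₚ monomial s τ *ₚ r) (basis (s + j)) 0
        ≡⟨ act-+* p (monomial s τ) r (basis (s + j)) 0 ⟩
      act p (basis (s + j)) 0 +ᶠ act (monomial s τ) (act r (basis (s + j))) 0
        ≡⟨ cong₂ _+ᶠ_ (act-basis p 0 (s + j)) (act-monomial s τ (act r (basis (s + j))) 0) ⟩
      coeff p (s + j) +ᶠ τ *ᶠ act r (basis (s + j)) s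
        ≡⟨ cong (λ x → coeff p (s + j) +ᶠ τ *ᶠ x) (act-basis r s j) ⟩
      coeff p (s + j) +ᶠ τ *ᶠ coeff r j  ∎

    top-cancels : ∀ j → n ≤ j → coeff p (s + j) +ᶠ τ *ᶠ coeff r j ≡ 0ᶠ
    top-cancels j n≤j with m≤n⇒m<n∨m≡n n≤j
    ... | inj₁ n<j = begin
      coeff p (s + j) +ᶠ τ *ᶠ coeff r j
        ≡⟨ cong₂ _+ᶠ_ (trans (p≈vp (s + j)) (toList-degreeBelow vp (s + j) m<s+j))
                      (cong (τ *ᶠ_) (trans (r≈vr j) (toList-degreeBelow vr j n<j))) ⟩
      0ᶠ +ᶠ τ *ᶠ 0ᶠ  ≡⟨ trans (+-identityˡ _) (zeroʳ τ) ⟩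
      0ᶠ             ∎
      where
      m<s+j : m < s + j
      m<s+j = subst (_< s + j) (m∸n+n≡m n≤m) (+-monoʳ-< s n<j)
    ... | inj₂ refl = begin
      coeff p (s + n) +ᶠ τ *ᶠ coeff r n
        ≡⟨ cong₂ _+ᶠ_ (trans (cong (coeff p) (m∸n+n≡m n≤m)) (trans (p≈vp m) (coeff-toList-last vp)))
                      (cong (τ *ᶠ_) (trans (r≈vr n) (coeff-toList-last vr))) ⟩
      last vp +ᶠ -ᶠ (last vp *ᶠ ι) *ᶠ last vr
        ≡⟨ cong (last vp +ᶠ_) (sym (-‿distribˡ-* _ _)) ⟩
      last vp +ᶠ -ᶠ ((last vp *ᶠ ι) *ᶠ last vr)
        ≡⟨ cong (λ x → last vp +ᶠ -ᶠ x) (trans (*-assoc _ _ _) (cong (last vp *ᶠ_) ι-inverse)) ⟩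
      last vp +ᶠ -ᶠ (last vp *ᶠ 1ᶠ)
        ≡⟨ cong (λ x → last vp +ᶠ -ᶠ x) (*-identityʳ _) ⟩
      last vp +ᶠ -ᶠ last vp
        ≡⟨ -‿inverseʳ _ ⟩
      0ᶠ  ∎
      where
      ι-inverse : ι *ᶠ last vr ≡ 1ᶠ
      ι-inverse = trans (*-comm ι _) (proj₂ (inv (last vr) vr≢0))

    degree : DegreeBelow m (p +ₚ monomial s τ *ₚ r)
    degree j m≤j = subst (λ x → coeff (p +ₚ monomial s τ *ₚ r) x ≡ 0ᶠ) (m+[n∸m]≡n s≤j)
                     (trans (coeff-shifted (j ∸ s)) (top-cancels (j ∸ s) n≤j∸s))
      where
      s≤j : s ≤ j
      s≤j = ≤-trans (m∸n≤m m n) m≤j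
      n≤j∸s : n ≤ j ∸ s
      n≤j∸s = subst (_≤ j ∸ s) (m∸[m∸n]≡n n≤m) (∸-monoˡ-≤ s m≤j)

  ∣ₚ⇒act : ∀ c p → c ∣ₚ p → Σ Poly λ s → ∀ z i → act p z i ≡ act s (act c z) i
  ∣ₚ⇒act c p (s , cs≈p) = s , λ z i → begin
    act p z i          ≡⟨ sym (act-resp-≈ₚ (c *ₚ s) p cs≈p z i) ⟩
    act (c *ₚ s) z i   ≡⟨ act-*ₚ c s z i ⟩
    act c (act s z) i  ≡⟨ act-comm c s z i ⟩
    act s (act c z) i  ∎

  act⇒∣ₚ : ∀ c p s → (∀ z i → act p z i ≡ act s (act c z) i) → c ∣ₚ p
  act⇒∣ₚ c p s p≗sc = s , act-injective (c *ₚ s) p λ z i → begin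
    act (c *ₚ s) z i   ≡⟨ act-*ₚ c s z i ⟩
    act c (act s z) i  ≡⟨ act-comm c s z i ⟩
    act s (act c z) i  ≡⟨ sym (p≗sc z i) ⟩
    act p z i          ∎

  ∣ₚ-annihilates : ∀ c p {z} → c ∣ₚ p → (∀ i → act c z i ≡ 0ᶠ) → ∀ i → act p z i ≡ 0ᶠ
  ∣ₚ-annihilates c p {z} c∣p cz≡0 i with ∣ₚ⇒act c p c∣p
  ... | s , p≗sc = trans (p≗sc z i) (act-vanishes s cz≡0 i)

  -- u p + v r = 1, read in the action on sequences, which is faithful (act-injective).
  Bezout : Poly → Poly → Set
  Bezout p r = Σ Poly λ u → Σ Poly λ v → ∀ z i → act u (act p z) i +ᶠ act v (act r z) i ≡ z i

  bezout-sym : ∀ p r → Bezout p r → Bezout r p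
  bezout-sym p r (u , v , uv) = v , u , λ z i → trans (+ᶠ-comm _ _) (uv z i)

  relPrime-sym : ∀ p r → RelPrime 𝔽 p r → RelPrime 𝔽 r p
  relPrime-sym p r coprime c c∣r c∣p = coprime c c∣p c∣r

  bezout-zeroˡ : ∀ p r → p ≈ₚ [] → RelPrime 𝔽 p r → Bezout p r
  bezout-zeroˡ p r p≈0 coprime = [] , s , λ z i → begin
    0ᶠ +ᶠ act s (act r z) i  ≡⟨ +-identityˡ _ ⟩
    act s (act r z) i        ≡⟨ sym (proj₂ (∣ₚ⇒act r (1ᶠ ∷ []) (s , rs≈1)) z i) ⟩
    act (1ᶠ ∷ []) z i        ≡⟨ act-singleton 1ᶠ z i ⟩
    1ᶠ *ᶠ z i                ≡⟨ *-identityˡ _ ⟩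
    z i                      ∎
    where
    r∣p : r ∣ₚ p
    r∣p = act⇒∣ₚ r p [] λ z i → act-vanishes-≈ₚ p p≈0 z i
    r∣r : r ∣ₚ r
    r∣r = act⇒∣ₚ r r (1ᶠ ∷ []) λ z i → sym (trans (act-singleton 1ᶠ (act r z) i) (*-identityˡ _))
    s : Poly
    s = proj₁ (coprime r r∣p r∣r)
    rs≈1 : r *ₚ s ≈ₚ 1ᶠ ∷ []
    rs≈1 = proj₂ (coprime r r∣p r∣r)

  bezout-+* : ∀ p r M → Bezout (p +ₚ M *ₚ r) r → Bezout p r
  bezout-+* p r M (u , v , uv) = u , v +ₚ u *ₚ M , λ z i → begin
    act u (act p z) i +ᶠ act (v +ₚ u *ₚ M) (act r z) i
      ≡⟨ cong (act u (act p z) i +ᶠ_) (act-+* v u M (act r z) i) ⟩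
    act u (act p z) i +ᶠ (act v (act r z) i +ᶠ act u (act M (act r z)) i)
      ≡⟨ x∙yz≈xz∙y _ _ _ ⟩
    (act u (act p z) i +ᶠ act u (act M (act r z)) i) +ᶠ act v (act r z) i
      ≡⟨ cong (_+ᶠ act v (act r z) i) (sym (act-+ₛ u (act p z) (act M (act r z)) i)) ⟩
    act u (act p z +ₛ act M (act r z)) i +ᶠ act v (act r z) i
      ≡⟨ cong (_+ᶠ act v (act r z) i) (act-cong u (λ m → sym (act-+* p M r z m)) i) ⟩
    act u (act (p +ₚ M *ₚ r) z) i +ᶠ act v (act r z) i
      ≡⟨ uv z i ⟩
    z i  ∎

  relPrime-+* : ∀ p r M → RelPrime 𝔽 p r → RelPrime 𝔽 (p +ₚ M *ₚ r) r
  relPrime-+* p r M coprime c c∣p′ c∣r = coprime c c∣p c∣r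
    where
    s₁ s₂ : Poly
    s₁ = proj₁ (∣ₚ⇒act c (p +ₚ M *ₚ r) c∣p′)
    s₂ = proj₁ (∣ₚ⇒act c r c∣r)
    c∣p : c ∣ₚ p
    c∣p = act⇒∣ₚ c p (s₁ +ₚ map -ᶠ_ (M *ₚ s₂)) λ z i → begin
      act p z i
        ≡⟨ sym (//-rightDividesʳ _ _) ⟩
      (act p z i +ᶠ act M (act r z) i) +ᶠ -ᶠ act M (act r z) i
        ≡⟨ cong₂ (λ x y → x +ᶠ -ᶠ y) (sym (act-+* p M r z i))
                                      (act-cong M (proj₂ (∣ₚ⇒act c r c∣r) z) i) ⟩
      act (p +ₚ M *ₚ r) z i +ᶠ -ᶠ act M (act s₂ (act c z)) i
        ≡⟨ cong₂ (λ x y → x +ᶠ -ᶠ y) (proj₂ (∣ₚ⇒act c (p +ₚ M *ₚ r) c∣p′) z i)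
                                      (sym (act-*ₚ M s₂ (act c z) i)) ⟩
      act s₁ (act c z) i +ᶠ -ᶠ act (M *ₚ s₂) (act c z) i
        ≡⟨ cong (act s₁ (act c z) i +ᶠ_) (sym (act-map-neg (M *ₚ s₂) (act c z) i)) ⟩
      act s₁ (act c z) i +ᶠ act (map -ᶠ_ (M *ₚ s₂)) (act c z) i
        ≡⟨ sym (act-+ₚ s₁ (map -ᶠ_ (M *ₚ s₂)) (act c z) i) ⟩
      act (s₁ +ₚ map -ᶠ_ (M *ₚ s₂)) (act c z) i  ∎

  relPrime⇒bezout : ∀ N p r {lp lr} → lp + lr < N → DegreeBelow lp p → DegreeBelow lr r →
                    RelPrime 𝔽 p r → Bezout p r
  relPrime⇒bezout zero    p r ()
  relPrime⇒bezout (suc N) p r {lp} {lr} (s≤s bound) deg-p deg-r coprime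
    with leadingForm p | leadingForm r
  ... | zeroPoly p≈0 | _             = bezout-zeroˡ p r p≈0 coprime
  ... | leading _ _ _ | zeroPoly r≈0 = bezout-sym r p (bezout-zeroˡ r p r≈0 (relPrime-sym p r coprime))
  ... | leading {m} vp vp≢0 p≈vp | leading {n} vr vr≢0 r≈vr with n ≤? m
  ...   | yes n≤m with cancel-leading p r vp vr vr≢0 n≤m p≈vp r≈vr
  ...     | M , deg-p′ =
    bezout-+* p r M (relPrime⇒bezout N (p +ₚ M *ₚ r) r bound′ deg-p′ deg-r (relPrime-+* p r M coprime))
    where
    bound′ : m + lr < N
    bound′ = <-≤-trans (+-monoˡ-< lr (leading-degree< p vp vp≢0 p≈vp deg-p)) bound
  relPrime⇒bezout (suc N) p r {lp} {lr} (s≤s bound) deg-p deg-r coprime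
    | leading {m} vp vp≢0 p≈vp | leading {n} vr vr≢0 r≈vr | no n≰m
    with cancel-leading r p vr vp vp≢0 (<⇒≤ (≰⇒> n≰m)) r≈vr p≈vp
  ...     | M , deg-r′ =
    bezout-sym r p (bezout-+* r p M (relPrime⇒bezout N (r +ₚ M *ₚ p) p bound′ deg-r′ deg-p coprime′))
    where
    coprime′ : RelPrime 𝔽 (r +ₚ M *ₚ p) p
    coprime′ = relPrime-+* r p M (relPrime-sym p r coprime)
    bound′ : n + lp < N
    bound′ = <-≤-trans (subst (_< lp + lr) (+-comm lp n) (+-monoʳ-< lp (leading-degree< r vr vr≢0 r≈vr deg-r))) bound

  module Recurrence {k} (a : Vec K (suc k)) (last≢0 : last a ≢ 0ᶠ) where

    private
      ι : K
      ι = proj₁ (inv (last a) last≢0)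

      last*ι≡1 : last a *ᶠ ι ≡ 1ᶠ
      last*ι≡1 = proj₂ (inv (last a) last≢0)

    solutions-vanish : ∀ N t → (∀ i → i < N → act (toList a) t i ≡ 0ᶠ) → (∀ m → m < k → t m ≡ 0ᶠ) →
                       ∀ m → m < N + k → t m ≡ 0ᶠ
    solutions-vanish zero    t at≡0 t₀ m m<k = t₀ m m<k
    solutions-vanish (suc N) t at≡0 t₀ = one-more (solutions-vanish N t (λ i i<N → at≡0 i (m<n⇒m<1+n i<N)) t₀)
      where
      one-more : (∀ m → m < N + k → t m ≡ 0ᶠ) → ∀ m → m < suc N + k → t m ≡ 0ᶠ
      one-more earlier m m<1+N+k with m<1+n⇒m<n∨m≡n m<1+N+k
      ... | inj₁ m<N+k = earlier m m<N+k
      ... | inj₂ refl  = x*y≡0⇒y≡0 last*ι≡1 (begin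
        last a *ᶠ t (N + k)                                ≡⟨ sym (+-identityˡ _) ⟩
        0ᶠ +ᶠ last a *ᶠ t (N + k)                          ≡⟨ cong (_+ᶠ last a *ᶠ t (N + k)) (sym window≡0) ⟩
        act (toList (init a)) t N +ᶠ last a *ᶠ t (N + k)  ≡⟨ sym (act-last a t N) ⟩
        act (toList a) t N                                 ≡⟨ at≡0 N ≤-refl ⟩
        0ᶠ                                                 ∎)
        where
        window≡0 : act (toList (init a)) t N ≡ 0ᶠ
        window≡0 = trans (act-local (init a) {t = 0ₛ} {j = 0} λ j j<k → earlier (N + j) (+-monoʳ-< N j<k))
                         (act-0ₛ (toList (init a)) 0)

    -- window δ m holds the k values of extend δ from m on; complete appends the value forced by the recurrence.
    private
      next : Seq → K
      next w = -ᶠ (ι *ᶠ act (toList (init a)) w 0)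

      complete : Seq → Seq
      complete w j with j <? k
      ... | yes _ = w j
      ... | no  _ = next w

      window : Seq → ℕ → Seq
      window δ zero    = δ
      window δ (suc m) = complete (window δ m) ∘ suc

    extend : Seq → Seq
    extend δ m = complete (window δ m) 0

    private
      complete-< : ∀ w {j} → j < k → complete w j ≡ w j
      complete-< w {j} j<k with j <? k
      ... | yes _  = refl
      ... | no j≮k = ⊥-elim (j≮k j<k)

      complete-k : ∀ w → complete w k ≡ next w
      complete-k w with k <? k
      ... | yes k<k = ⊥-elim (<-irrefl refl k<k)
      ... | no _    = refl

      window-extend : ∀ δ j m → j ≤ k → complete (window δ m) j ≡ extend δ (m + j)
      window-extend δ zero    m _   = cong (extend δ) (sym (+-identityʳ m))
      window-extend δ (suc j) m j<k = begin
        complete (window δ m) (suc j)  ≡⟨ sym (complete-< (window δ (suc m)) j<k) ⟩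
        complete (window δ (suc m)) j  ≡⟨ window-extend δ j (suc m) (<⇒≤ j<k) ⟩
        extend δ (suc m + j)           ≡⟨ cong (extend δ) (sym (+-suc m j)) ⟩
        extend δ (m + suc j)           ∎

    extend-init : ∀ δ m → m < k → extend δ m ≡ δ m
    extend-init δ m m<k = trans (sym (window-extend δ m 0 (<⇒≤ m<k))) (complete-< δ m<k)

    extend-solves : ∀ δ i → act (toList a) (extend δ) i ≡ 0ᶠ
    extend-solves δ i = begin
      act (toList a) (extend δ) i
        ≡⟨ act-last a (extend δ) i ⟩
      act (toList (init a)) (extend δ) i +ᶠ last a *ᶠ extend δ (i + k)
        ≡⟨ cong₂ _+ᶠ_ (act-local (init a) λ j j<k → trans (sym (window-extend δ j i (<⇒≤ j<k)))
                                                             (complete-< (window δ i) j<k))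
                      (cong (last a *ᶠ_) (trans (sym (window-extend δ k i ≤-refl)) (complete-k (window δ i)))) ⟩
      L +ᶠ last a *ᶠ -ᶠ (ι *ᶠ L)
        ≡⟨ cong (L +ᶠ_) (sym (-‿distribʳ-* (last a) (ι *ᶠ L))) ⟩
      L +ᶠ -ᶠ (last a *ᶠ (ι *ᶠ L))
        ≡⟨ cong (λ x → L +ᶠ -ᶠ x) (trans (sym (*-assoc _ ι L))
                                          (trans (cong (_*ᶠ L) last*ι≡1) (*-identityˡ L))) ⟩
      L +ᶠ -ᶠ L
        ≡⟨ -‿inverseʳ L ⟩
      0ᶠ  ∎
      where
      L = act (toList (init a)) (window δ i) 0

  bezout⇒kernel-trivial : ∀ {k} (a b : Vec K (suc k)) → last a ≢ 0ᶠ → Bezout (toList a) (toList b) →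
                          ∀ δ → (∀ i → i < k → act (toList a) δ i ≡ 0ᶠ) →
                                (∀ i → i < k → act (toList b) δ i ≡ 0ᶠ) →
                          ∀ m → m < k + k → δ m ≡ 0ᶠ
  bezout⇒kernel-trivial {k} a b last≢0 (u , v , uv) δ aδ≡0 bδ≡0 m m<2k = trans (sym (z≡δ m m<2k)) (z≡0 m)
    where
    open Recurrence a last≢0

    z : Seq
    z = extend δ

    z≡δ : ∀ m → m < k + k → z m ≡ δ m
    z≡δ m m<2k = x∙y⁻¹≈ε⇒x≈y _ _ (solutions-vanish k (z -ₛ δ) difference-solves difference-init m m<2k)
      where
      difference-solves : ∀ i → i < k → act (toList a) (z -ₛ δ) i ≡ 0ᶠ
      difference-solves i i<k = begin
        act (toList a) (z -ₛ δ) i                       ≡⟨ act--ₛ (toList a) z δ i ⟩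
        act (toList a) z i +ᶠ -ᶠ act (toList a) δ i
          ≡⟨ cong₂ (λ x y → x +ᶠ -ᶠ y) (extend-solves δ i) (aδ≡0 i i<k) ⟩
        0ᶠ +ᶠ -ᶠ 0ᶠ  ≡⟨ -‿inverseʳ 0ᶠ ⟩
        0ᶠ           ∎
      difference-init : ∀ m → m < k → (z -ₛ δ) m ≡ 0ᶠ
      difference-init m m<k = trans (cong (_+ᶠ -ᶠ δ m) (extend-init δ m m<k)) (-‿inverseʳ (δ m))

    bz≡0 : ∀ m → act (toList b) z m ≡ 0ᶠ
    bz≡0 m = solutions-vanish (suc m) (act (toList b) z) (λ i _ → bz-solves i) bz-init m (s≤s (m≤m+n m k))
      where
      bz-solves : ∀ i → act (toList a) (act (toList b) z) i ≡ 0ᶠ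
      bz-solves i = trans (act-comm (toList a) (toList b) z i) (act-vanishes (toList b) (extend-solves δ) i)
      bz-init : ∀ i → i < k → act (toList b) z i ≡ 0ᶠ
      bz-init i i<k = trans (act-local b λ j j≤k → z≡δ (i + j) (+-mono-<-≤ i<k (≤-pred j≤k))) (bδ≡0 i i<k)

    z≡0 : ∀ m → z m ≡ 0ᶠ
    z≡0 m = begin
      z m                                                     ≡⟨ sym (uv z m) ⟩
      act u (act (toList a) z) m +ᶠ act v (act (toList b) z) m ≡⟨ cong₂ _+ᶠ_ (act-vanishes u (extend-solves δ) m)
                                                                              (act-vanishes v bz≡0 m) ⟩
      0ᶠ +ᶠ 0ᶠ                                                ≡⟨ +-identityˡ 0ᶠ ⟩
      0ᶠ                                                      ∎

  seqOf : ∀ {n} → Vec K n → Seq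
  seqOf []       _       = 0ᶠ
  seqOf (x ∷ xs) zero    = x
  seqOf (x ∷ xs) (suc m) = seqOf xs m

  lookup-seqOf : ∀ {n} (v : Vec K n) f → lookup v f ≡ seqOf v (toℕ f)
  lookup-seqOf (x ∷ v) Fin.zero    = refl
  lookup-seqOf (x ∷ v) (Fin.suc f) = lookup-seqOf v f

  seqOf-injective : ∀ {n} (v w : Vec K n) → (∀ m → m < n → seqOf v m ≡ seqOf w m) → v ≡ w
  seqOf-injective []      []      _   = refl
  seqOf-injective (x ∷ v) (y ∷ w) v≗w =
    cong₂ _∷_ (v≗w 0 (s≤s z≤n)) (seqOf-injective v w λ m m<n → v≗w (suc m) (s≤s m<n))

  prefix : ∀ n → Seq → Vec K n
  prefix n z = tabulate (z ∘ toℕ)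

  seqOf-prefix : ∀ n z m → m < n → seqOf (prefix n z) m ≡ z m
  seqOf-prefix (suc n) z zero    _         = refl
  seqOf-prefix (suc n) z (suc m) (s≤s m<n) = seqOf-prefix n (z ∘ suc) m m<n

  linearRule-window : ∀ {n} (a : Vec K n) (g : Fin n → K) s m → (∀ j → g j ≡ s (m + toℕ j)) →
                      linearRule 𝔽 a (tabulate g) ≡ act (toList a) s m
  linearRule-window []      g s m g≗s = refl
  linearRule-window (c ∷ a) g s m g≗s =
    cong₂ _+ᶠ_ (cong (c *ᶠ_) (trans (g≗s Fin.zero) (cong s (+-identityʳ m))))
               (linearRule-window a (g ∘ Fin.suc) s (suc m) λ j → trans (g≗s (Fin.suc j)) (cong s (+-suc m (toℕ j))))

  noBoundaryCA-lookup : ∀ {n d} (d≤n : d ≤ n) (a : Vec K d) w f →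
                        lookup (noBoundaryCA 𝔽 d≤n (linearRule 𝔽 a) w) f ≡ act (toList a) (seqOf w) (toℕ f)
  noBoundaryCA-lookup {n} {d} d≤n a w f =
    trans (lookup∘tabulate (λ i → linearRule 𝔽 a (tabulate λ j → lookup w (fromℕ< (window< i j)))) f)
          (linearRule-window a _ (seqOf w) (toℕ f) λ j → trans (lookup-seqOf w _) (cong (seqOf w) (toℕ-fromℕ< _)))
    where
    window< : (i : Fin (suc (n ∸ d))) (j : Fin d) → toℕ i + toℕ j < n
    window< i j = subst (toℕ i + toℕ j <_) (m∸n+n≡m d≤n) (+-mono-≤-< (toℕ≤pred[n] i) (toℕ<n j))

  CA2-lookup : ∀ d 2≤d (a : Vec K d) w f →
               lookup (CA2 𝔽 d 2≤d (linearRule 𝔽 a) w) f ≡ act (toList a) (seqOf w) (toℕ f)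
  CA2-lookup d 2≤d a w f =
    trans (lookup-cast₁ (len≡d-1 d 2≤d) _ f)
          (trans (noBoundaryCA-lookup (d≤2[d-1] d 2≤d) a w _)
                 (cong (act (toList a) (seqOf w)) (toℕ-cast (sym (len≡d-1 d 2≤d)) f)))

  CA2-≡⇔ : ∀ d 2≤d (a : Vec K d) w w′ →
           CA2 𝔽 d 2≤d (linearRule 𝔽 a) w ≡ CA2 𝔽 d 2≤d (linearRule 𝔽 a) w′ ⇔
           (∀ i → i < d ∸ 1 → act (toList a) (seqOf w) i ≡ act (toList a) (seqOf w′) i)
  CA2-≡⇔ d 2≤d a w w′ = mk⇔ windows-agree outputs-agree
    where
    F : Vec K ((d ∸ 1) + (d ∸ 1)) → Vec K (d ∸ 1)
    F = CA2 𝔽 d 2≤d (linearRule 𝔽 a)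

    windows-agree : F w ≡ F w′ → ∀ i → i < d ∸ 1 → act (toList a) (seqOf w) i ≡ act (toList a) (seqOf w′) i
    windows-agree Fw≡Fw′ i i<d-1 = begin
      act (toList a) (seqOf w) i          ≡⟨ cong (act (toList a) (seqOf w)) (sym (toℕ-fromℕ< i<d-1)) ⟩
      act (toList a) (seqOf w) (toℕ f)    ≡⟨ sym (CA2-lookup d 2≤d a w f) ⟩
      lookup (F w) f                      ≡⟨ cong (λ v → lookup v f) Fw≡Fw′ ⟩
      lookup (F w′) f                     ≡⟨ CA2-lookup d 2≤d a w′ f ⟩
      act (toList a) (seqOf w′) (toℕ f)   ≡⟨ cong (act (toList a) (seqOf w′)) (toℕ-fromℕ< i<d-1) ⟩
      act (toList a) (seqOf w′) i         ∎
      where f = fromℕ< i<d-1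

    outputs-agree : (∀ i → i < d ∸ 1 → act (toList a) (seqOf w) i ≡ act (toList a) (seqOf w′) i) → F w ≡ F w′
    outputs-agree windows≡ = begin
      F w                    ≡⟨ sym (tabulate∘lookup (F w)) ⟩
      tabulate (lookup (F w))  ≡⟨ tabulate-cong (λ f → trans (CA2-lookup d 2≤d a w f)
                                   (trans (windows≡ (toℕ f) (toℕ<n f)) (sym (CA2-lookup d 2≤d a w′ f)))) ⟩
      tabulate (lookup (F w′)) ≡⟨ tabulate∘lookup (F w′) ⟩
      F w′                   ∎

  orthogonal⇔injective : ∀ {k} (φ : Vec K k ↔ Fin (q ^ k)) (F G : Vec K (k + k) → Vec K k) →
                         Orthogonal (latinSquare 𝔽 φ F) (latinSquare 𝔽 φ G) ⇔ JointlyInjective F G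
  orthogonal⇔injective {k} φ F G = mk⇔ injective orthogonal
    where
    open Inverse φ using (to; from; strictlyInverseʳ)

    to-injective : ∀ {x y} → to x ≡ to y → x ≡ y
    to-injective = Injection.injective (↔⇒↣ φ)

    from-injective : ∀ {i j} → from i ≡ from j → i ≡ j
    from-injective = Injection.injective (↔⇒↣ (↔-sym φ))

    square-at : ∀ H x y → latinSquare 𝔽 φ H (to x) (to y) ≡ to (H (x ++ y))
    square-at H x y = cong (to ∘ H) (cong₂ _++_ (strictlyInverseʳ x) (strictlyInverseʳ y))

    injective : Orthogonal (latinSquare 𝔽 φ F) (latinSquare 𝔽 φ G) → JointlyInjective F G
    injective orthogonal w w′ Fw≡Fw′ Gw≡Gw′ with splitAt k w | splitAt k w′
    ... | x , y , refl | x′ , y′ , refl = cong₂ _++_ (to-injective (proj₁ halves≡)) (to-injective (proj₂ halves≡))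
      where
      same-entry : ∀ H → H (x ++ y) ≡ H (x′ ++ y′) →
                   latinSquare 𝔽 φ H (to x) (to y) ≡ latinSquare 𝔽 φ H (to x′) (to y′)
      same-entry H Hw≡Hw′ = trans (square-at H x y) (trans (cong to Hw≡Hw′) (sym (square-at H x′ y′)))
      halves≡ : to x ≡ to x′ × to y ≡ to y′
      halves≡ = orthogonal (to x) (to y) (to x′) (to y′) (same-entry F Fw≡Fw′) (same-entry G Gw≡Gw′)

    orthogonal : JointlyInjective F G → Orthogonal (latinSquare 𝔽 φ F) (latinSquare 𝔽 φ G)
    orthogonal injective i j i′ j′ Fij≡Fi′j′ Gij≡Gi′j′ =
      from-injective (proj₁ halves≡) , from-injective (proj₂ halves≡)
      where
      halves≡ : from i ≡ from i′ × from j ≡ from j′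
      halves≡ = ++-injective (from i) (from i′) (injective _ _ (to-injective Fij≡Fi′j′) (to-injective Gij≡Gi′j′))

  LinearCA : ∀ d → 2 ≤ d → Vec K d → Vec K ((d ∸ 1) + (d ∸ 1)) → Vec K (d ∸ 1)
  LinearCA d 2≤d a = CA2 𝔽 d 2≤d (linearRule 𝔽 a)

  relPrime⇒injective : ∀ {k} (2≤d : 2 ≤ suc k) (a b : Vec K (suc k)) → last a ≢ 0ᶠ →
                       RelPrime 𝔽 (toList a) (toList b) →
                       JointlyInjective (LinearCA (suc k) 2≤d a) (LinearCA (suc k) 2≤d b)
  relPrime⇒injective {k} 2≤d a b last≢0 coprime w w′ Fw≡Fw′ Gw≡Gw′ =
    seqOf-injective w w′ λ m m<2k → x∙y⁻¹≈ε⇒x≈y _ _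
      (bezout⇒kernel-trivial a b last≢0 bezout (seqOf w -ₛ seqOf w′) (kills a Fw≡Fw′) (kills b Gw≡Gw′) m m<2k)
    where
    bezout : Bezout (toList a) (toList b)
    bezout = relPrime⇒bezout (suc (suc k + suc k)) (toList a) (toList b) ≤-refl
                             (toList-degreeBelow a) (toList-degreeBelow b) coprime
    kills : ∀ c → LinearCA (suc k) 2≤d c w ≡ LinearCA (suc k) 2≤d c w′ →
            ∀ i → i < k → act (toList c) (seqOf w -ₛ seqOf w′) i ≡ 0ᶠ
    kills c Cw≡Cw′ i i<k = trans (act--ₛ (toList c) (seqOf w) (seqOf w′) i)
                                 (x≈y⇒x∙y⁻¹≈ε (Equivalence.to (CA2-≡⇔ (suc k) 2≤d c w w′) Cw≡Cw′ i i<k))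

  positive-degree⇒nonzero-solution : ∀ {n} (v : Vec K (suc (suc n))) → last v ≢ 0ᶠ →
                                      Σ Seq λ z → z 0 ≡ 1ᶠ × (∀ i → act (toList v) z i ≡ 0ᶠ)
  positive-degree⇒nonzero-solution v last≢0 =
    extend (basis 0) , extend-init (basis 0) 0 (s≤s z≤n) , extend-solves (basis 0)
    where open Recurrence v last≢0

  annihilated⇒same-output : ∀ {k} (2≤d : 2 ≤ suc k) (p : Vec K (suc k)) z → (∀ i → act (toList p) z i ≡ 0ᶠ) →
                            LinearCA (suc k) 2≤d p (prefix (k + k) z) ≡ LinearCA (suc k) 2≤d p (prefix (k + k) 0ₛ)
  annihilated⇒same-output {k} 2≤d p z pz≡0 =
    Equivalence.from (CA2-≡⇔ (suc k) 2≤d p (prefix (k + k) z) (prefix (k + k) 0ₛ)) λ i i<k →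
      trans (trans (act-on-prefix z i<k) (pz≡0 i)) (sym (trans (act-on-prefix 0ₛ i<k) (act-0ₛ (toList p) i)))
    where
    act-on-prefix : ∀ y {i} → i < k → act (toList p) (seqOf (prefix (k + k) y)) i ≡ act (toList p) y i
    act-on-prefix y {i} i<k = act-local p λ j j≤k → seqOf-prefix (k + k) y (i + j) (+-mono-<-≤ i<k (≤-pred j≤k))

  zero∣ₚ⇒zero : ∀ c p → c ≈ₚ [] → c ∣ₚ p → p ≈ₚ []
  zero∣ₚ⇒zero c p c≈0 c∣p = act-injective p [] λ z → ∣ₚ-annihilates c p c∣p (act-vanishes-≈ₚ c c≈0 z)

  injective⇒relPrime : ∀ {k} (2≤d : 2 ≤ suc k) (a b : Vec K (suc k)) → lookup a Fin.zero ≢ 0ᶠ →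
                       JointlyInjective (LinearCA (suc k) 2≤d a) (LinearCA (suc k) 2≤d b) →
                       RelPrime 𝔽 (toList a) (toList b)
  injective⇒relPrime {k} 2≤d (a₀ ∷ a) b a₀≢0 injective c c∣a c∣b with leadingForm c
  ... | zeroPoly c≈0 = ⊥-elim (a₀≢0 (zero∣ₚ⇒zero c (a₀ ∷ toList a) c≈0 c∣a 0))
  ... | leading {zero} (x ∷ []) x≢0 c≈x =
    x⁻¹ ∷ [] , act-injective (c *ₚ (x⁻¹ ∷ [])) (1ᶠ ∷ []) λ z i → begin
      act (c *ₚ (x⁻¹ ∷ [])) z i          ≡⟨ act-*ₚ c (x⁻¹ ∷ []) z i ⟩
      act c (act (x⁻¹ ∷ []) z) i         ≡⟨ act-resp-≈ₚ c (x ∷ []) c≈x (act (x⁻¹ ∷ []) z) i ⟩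
      act (x ∷ []) (act (x⁻¹ ∷ []) z) i  ≡⟨ act-singleton x (act (x⁻¹ ∷ []) z) i ⟩
      x *ᶠ act (x⁻¹ ∷ []) z i            ≡⟨ cong (x *ᶠ_) (act-singleton x⁻¹ z i) ⟩
      x *ᶠ (x⁻¹ *ᶠ z i)                  ≡⟨ sym (*-assoc x x⁻¹ (z i)) ⟩
      (x *ᶠ x⁻¹) *ᶠ z i                  ≡⟨ cong (_*ᶠ z i) (proj₂ (inv x x≢0)) ⟩
      1ᶠ *ᶠ z i                          ≡⟨ sym (act-singleton 1ᶠ z i) ⟩
      act (1ᶠ ∷ []) z i                  ∎
    where
    x⁻¹ : K
    x⁻¹ = proj₁ (inv x x≢0)
  ... | leading {suc n} v v≢0 c≈v with positive-degree⇒nonzero-solution v v≢0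
  ...   | z , z0≡1 , vz≡0 = ⊥-elim (0≢1 (sym (begin
      1ᶠ                           ≡⟨ sym z0≡1 ⟩
      z 0                          ≡⟨ sym (seqOf-prefix (k + k) z 0 0<2k) ⟩
      seqOf (prefix (k + k) z) 0   ≡⟨ cong (λ w → seqOf w 0) prefixes≡ ⟩
      seqOf (prefix (k + k) 0ₛ) 0  ≡⟨ seqOf-prefix (k + k) 0ₛ 0 0<2k ⟩
      0ᶠ                           ∎)))
    where
    cz≡0 : ∀ i → act c z i ≡ 0ᶠ
    cz≡0 i = trans (act-resp-≈ₚ c (toList v) c≈v z i) (vz≡0 i)
    prefixes≡ : prefix (k + k) z ≡ prefix (k + k) 0ₛ
    prefixes≡ = injective _ _
      (annihilated⇒same-output 2≤d (a₀ ∷ a) z (∣ₚ-annihilates c (toList (a₀ ∷ a)) c∣a cz≡0))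
      (annihilated⇒same-output 2≤d b z (∣ₚ-annihilates c (toList b) c∣b cz≡0))
    0<2k : 0 < k + k
    0<2k = ≤-trans (s≤s⁻¹ 2≤d) (m≤m+n k k)

  bipermutive⇒head≢0 : ∀ {k} (a : Vec K (suc k)) → Bipermutive 𝔽 a → lookup a Fin.zero ≢ 0ᶠ
  bipermutive⇒head≢0 a bipermutive = bipermutive Fin.zero (inj₁ refl)

  bipermutive⇒last≢0 : ∀ {k} (a : Vec K (suc k)) → Bipermutive 𝔽 a → last a ≢ 0ᶠ
  bipermutive⇒last≢0 {k} a bipermutive =
    bipermutive (fromℕ k) (inj₂ (cong suc (toℕ-fromℕ k))) ∘ trans (lookup-fromℕ a)

theorem1 : (𝔽 : FiniteField) (d : ℕ) (2≤d : 2 ≤ d)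
           (a b : Vec (FiniteField.K 𝔽) d) →
           Bipermutive 𝔽 a → Bipermutive 𝔽 b →
           (φ : Vec (FiniteField.K 𝔽) (d ∸ 1) ↔ Fin (FiniteField.q 𝔽 ^ (d ∸ 1))) →
           Orthogonal (latinSquare 𝔽 φ (CA2 𝔽 d 2≤d (linearRule 𝔽 a)))
                      (latinSquare 𝔽 φ (CA2 𝔽 d 2≤d (linearRule 𝔽 b)))
           ⇔ RelPrime 𝔽 (rulePoly 𝔽 a) (rulePoly 𝔽 b)
theorem1 𝔽 (suc k) 2≤d a b bipermutive-a _ φ =
  mk⇔ (injective⇒relPrime 𝔽 2≤d a b (bipermutive⇒head≢0 𝔽 a bipermutive-a) ∘ to)
      (from ∘ relPrime⇒injective 𝔽 2≤d a b (bipermutive⇒last≢0 𝔽 a bipermutive-a))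
  where open Equivalence (orthogonal⇔injective 𝔽 φ (LinearCA 𝔽 (suc k) 2≤d a) (LinearCA 𝔽 (suc k) 2≤d b))
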